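{- Let $\vec S=\varprojlim(\vec S_p\mid p\in P)$ be the inverse limit of an inverse system of finite separation systems. Let $\vec r,\vec s$ be elements of a nested set $\tau\subseteq\vec S$, and let $p\in P$. Assume that $r\restriction p\ne s\restriction p$, that neither $\vec r\restriction p$ nor $\overleftarrow s\restriction p$ is trivial in $\tau\restriction p$, and that $\vec r\restriction p\le\vec s\restriction p$. Then $r\ne s$ and $\vec r\le\vec s$.
   Context: A separation system is a poset with an order-reversing involution $\vec s\mapsto\overleftarrow s$; $s=\{\vec s,\overleftarrow s\}$. Two separations are nested if they have comparable orientations; a set is nested if its elements are pairwise nested. An element $\vec x\in\vec S_p$ is trivial in a set $\rho\subseteq\vec S_p$ if there is a separation $t\ne x$ having an orientation in $\rho$ with $\vec x<\vec t$ and $\vec x<\overleftarrow t$. Inverse system: directed poset $P$, homomorphisms $f_{qp}$ commuting with involutions and preserving $\le$, compatible; $\vec S$ consists of compatible families $(\vec s_p)$ with componentwise order and involution; $\vec s\restriction p:=\vec s_p$, $s\restriction p:=\{\vec s_p,\overleftarrow{s_p}\}$, $\tau\restriction p:=\{\vec t\restriction p:\vec t\in\tau\}$. -}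

module Defs where

open import Data.Nat using (ℕ)
open import Data.Fin using (Fin)
open import Data.Product using (Σ; ∃; _×_; _,_)
open import Data.Sum using (_⊎_)
open import Relation.Nullary using (¬_)
open import Relation.Binary.PropositionalEquality using (_≡_)

record SepSys : Set₁ where
  field
    Sep       : Set
    _≤_       : Sep → Sep → Set
    ≤-refl    : ∀ {a} → a ≤ a
    ≤-trans   : ∀ {a b c} → a ≤ b → b ≤ c → a ≤ c
    ≤-antisym : ∀ {a b} → a ≤ b → b ≤ a → a ≡ b
    _*        : Sep → Sep
    *-invol   : ∀ a → (a *) * ≡ a
    *-rev     : ∀ {a b} → a ≤ b → (b *) ≤ (a *)

  _<_ : Sep → Sep → Set
  a < b = (a ≤ b) × ¬ (a ≡ b)

  -- the unoriented separations {a, a*} and {b, b*} are equal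
  SameSep : Sep → Sep → Set
  SameSep a b = (a ≡ b) ⊎ (a ≡ b *)

  Trivial : Sep → (Sep → Set) → Set
  Trivial x ρ = Σ Sep λ t → ρ t × ¬ SameSep t x × (x < t) × (x < (t *))

Finite : Set → Set
Finite A = Σ ℕ λ n → Σ (Fin n → A) λ f → ∀ a → ∃ λ i → f i ≡ a

record DirectedPoset : Set₁ where
  field
    Idx       : Set
    _≼_       : Idx → Idx → Set
    ≼-refl    : ∀ {p} → p ≼ p
    ≼-trans   : ∀ {p q r} → p ≼ q → q ≼ r → p ≼ r
    ≼-antisym : ∀ {p q} → p ≼ q → q ≼ p → p ≡ q
    directed  : ∀ p q → ∃ λ r → (p ≼ r) × (q ≼ r)

record InverseSystem (P : DirectedPoset) : Set₁ where
  open DirectedPoset P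
  field
    S       : Idx → SepSys
    finite  : ∀ p → Finite (SepSys.Sep (S p))
    -- f {p} {q} h is the bonding map f_qp : S_q → S_p for p ≤ q
    f       : ∀ {p q} → p ≼ q → SepSys.Sep (S q) → SepSys.Sep (S p)
    f-*     : ∀ {p q} (h : p ≼ q) (a : SepSys.Sep (S q)) →
              f h (SepSys._* (S q) a) ≡ SepSys._* (S p) (f h a)
    f-≤     : ∀ {p q} (h : p ≼ q) {a b : SepSys.Sep (S q)} →
              SepSys._≤_ (S q) a b → SepSys._≤_ (S p) (f h a) (f h b)
    f-comp  : ∀ {p q r} (h₁ : p ≼ q) (h₂ : q ≼ r) (h₃ : p ≼ r)
              (a : SepSys.Sep (S r)) → f h₁ (f h₂ a) ≡ f h₃ a

  record Lim : Set where
    constructor lim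
    field
      at     : (p : Idx) → SepSys.Sep (S p)
      compat : ∀ {p q} (h : p ≼ q) → f h (at q) ≡ at p
  open Lim public

  _↾_ : Lim → (p : Idx) → SepSys.Sep (S p)
  s ↾ p = at s p

  _≤L_ : Lim → Lim → Set
  r ≤L s = ∀ p → SepSys._≤_ (S p) (r ↾ p) (s ↾ p)

  _*L : Lim → Lim
  at (s *L) p = SepSys._* (S p) (s ↾ p)
  compat (s *L) {p} {q} h rewrite f-* h (s ↾ q) | compat s h = Relation.Binary.PropositionalEquality.refl

  _≈L_ : Lim → Lim → Set
  r ≈L s = ∀ p → r ↾ p ≡ s ↾ p

  SameSepL : Lim → Lim → Set
  SameSepL r s = (r ≈L s) ⊎ (r ≈L (s *L))

  NestedPair : Lim → Lim → Set
  NestedPair r s = (r ≤L s) ⊎ (r ≤L (s *L)) ⊎ ((r *L) ≤L s) ⊎ ((r *L) ≤L (s *L))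

  Nested : (Lim → Set) → Set
  Nested τ = ∀ r s → τ r → τ s → NestedPair r s

  _↾set_ : (Lim → Set) → (p : Idx) → SepSys.Sep (S p) → Set
  (τ ↾set p) a = Σ Lim λ t → τ t × (t ↾ p ≡ a)

-- If r⃗ and s⃗ were nested in τ in any way other than r⃗ ≤ s⃗, restricting to p
-- would, together with r⃗↾p ≤ s⃗↾p, make r⃗↾p lie below both orientations of
-- s↾p, or s⃖↾p below both orientations of r↾p, or force r↾p = s↾p.  The first
-- two make r⃗↾p resp. s⃖↾p trivial in τ↾p, the third contradicts r↾p ≠ s↾p.
module Submission where

open import Defs
open import Data.Empty using (⊥-elim)
open import Data.Product using (_×_; _,_)
open import Data.Sum using (inj₁; inj₂)
open import Relation.Nullary using (¬_)
open import Relation.Binary.PropositionalEquality using (_≡_; refl; sym; trans; cong; subst)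

module SepSysProperties (X : SepSys) where
  open SepSys X

  *-injective : ∀ {a b} → (a *) ≡ (b *) → a ≡ b
  *-injective {a} {b} e = trans (sym (*-invol a)) (trans (cong _* e) (*-invol b))

  *-swap-≡ : ∀ {a b} → a ≡ b * → b ≡ a *
  *-swap-≡ {a} {b} e = trans (sym (*-invol b)) (cong _* (sym e))

  SameSep-sym : ∀ {a b} → SameSep a b → SameSep b a
  SameSep-sym (inj₁ e) = inj₁ (sym e)
  SameSep-sym (inj₂ e) = inj₂ (*-swap-≡ e)

  SameSep-*ˡ : ∀ {a b} → SameSep (a *) b → SameSep a b
  SameSep-*ˡ (inj₁ e) = inj₂ (*-swap-≡ (sym e))
  SameSep-*ˡ (inj₂ e) = inj₁ (*-injective e)

  *-swap-≤ : ∀ {a b} → (a *) ≤ b → (b *) ≤ a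
  *-swap-≤ {a} {b} h = subst ((b *) ≤_) (*-invol a) (*-rev h)

  *-reflects-≤ : ∀ {a b} → (a *) ≤ (b *) → b ≤ a
  *-reflects-≤ {a} {b} h = subst (_≤ a) (*-invol b) (*-swap-≤ h)

  trivial-below-both : ∀ {a b} (ρ : Sep → Set) → ρ b → ¬ SameSep a b →
                       a ≤ b → a ≤ (b *) → Trivial a ρ
  trivial-below-both ρ ρb a≠b a≤b a≤b* =
    _ , ρb , (λ b~a → a≠b (SameSep-sym b~a))
      , (a≤b , λ e → a≠b (inj₁ e)) , (a≤b* , λ e → a≠b (inj₂ e))

  module NontrivialPair {a b} (ρ : Sep → Set) (ρa : ρ a) (ρb : ρ b)
                        (a≠b : ¬ SameSep a b) (a-nontrivial : ¬ Trivial a ρ)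
                        (b*-nontrivial : ¬ Trivial (b *) ρ) (a≤b : a ≤ b) where

    a≰b* : ¬ a ≤ (b *)
    a≰b* a≤b* = a-nontrivial (trivial-below-both ρ ρb a≠b a≤b a≤b*)

    a*≰b : ¬ (a *) ≤ b
    a*≰b a*≤b = b*-nontrivial
      (trivial-below-both ρ ρa (λ b*~a → a≠b (SameSep-sym (SameSep-*ˡ b*~a)))
                          (*-swap-≤ a*≤b) (*-rev a≤b))

    a*≰b* : ¬ (a *) ≤ (b *)
    a*≰b* a*≤b* = a≠b (inj₁ (≤-antisym a≤b (*-reflects-≤ a*≤b*)))

lemma5p3 : (P : DirectedPoset) (I : InverseSystem P) →
    let open DirectedPoset P
        open InverseSystem I
    in (τ : Lim → Set) → Nested τ → (r s : Lim) → τ r → τ s → (p : Idx) →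
       ¬ SepSys.SameSep (S p) (r ↾ p) (s ↾ p) →
       ¬ SepSys.Trivial (S p) (r ↾ p) (τ ↾set p) →
       ¬ SepSys.Trivial (S p) ((s *L) ↾ p) (τ ↾set p) →
       SepSys._≤_ (S p) (r ↾ p) (s ↾ p) →
       (¬ SameSepL r s) × (r ≤L s)
lemma5p3 P I τ nested r s τr τs p r≠s r-nontrivial s*-nontrivial r≤s =
  r≠ᴸs , r≤ᴸs
  where
  open InverseSystem I
  open SepSysProperties.NontrivialPair (S p) (τ ↾set p) (r , τr , refl) (s , τs , refl)
                                       r≠s r-nontrivial s*-nontrivial r≤s

  r≠ᴸs : ¬ SameSepL r s
  r≠ᴸs (inj₁ r≈s)  = r≠s (inj₁ (r≈s p))
  r≠ᴸs (inj₂ r≈s*) = r≠s (inj₂ (r≈s* p))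

  r≤ᴸs : r ≤L s
  r≤ᴸs with nested r s τr τs
  ... | inj₁ r≤ᴸs                = r≤ᴸs
  ... | inj₂ (inj₁ r≤s*)         = ⊥-elim (a≰b* (r≤s* p))
  ... | inj₂ (inj₂ (inj₁ r*≤s))  = ⊥-elim (a*≰b (r*≤s p))
  ... | inj₂ (inj₂ (inj₂ r*≤s*)) = ⊥-elim (a*≰b* (r*≤s* p))
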